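{- For every integer $w\ge5$ there exists a signature $\sigma$ of width $w$ such that \[ \prod_{i=0}^{w-1}\bigl|\boldsymbol{\tau}^{\sigma}_{i+1}\bigr|^{\binom{w-1}{i}} \;\ge\; \bigl|\boldsymbol{\tau}^{\sigma}_w\bigr|^{\,2^{w/10}\cdot(w+1)^{ -2}}. \]
   Context: A signature $\sigma=\mathrm{Rels}\uplus\mathrm{Cons}$ is a finite set of relation symbols $\mathrm{Rels}$ (nonempty, arities $\ge1$) and constant symbols $\mathrm{Cons}$; its width is the maximal arity of its relation symbols. For $k\in\mathbb{N}$, $\mathrm{Lit}_k(\sigma)$ is the set of atoms $R(t_1,\dots,t_{\mathrm{ar}(R)})$ with $R\in\mathrm{Rels}$, $t_i\in\{x_1,\dots,x_k\}\cup\mathrm{Cons}$, together with their negations; a $k$-type over $\sigma$ is a subset of $\mathrm{Lit}_k(\sigma)$ containing exactly one of each atom and its negation, and $\boldsymbol{\tau}^\sigma_k$ is the set of all $k$-types (so $|\boldsymbol{\tau}^{\sigma}_k|=\prod_{R\in\mathrm{Rels}}2^{(k+|\mathrm{Cons}|)^{\mathrm{ar}(R)}}$). -}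

module Defs where

open import Data.Nat using (ℕ; zero; suc; _+_; _*_; _^_; _≤_; _⊔_)
open import Data.List using (List; []; _∷_; map; upTo; foldr)
open import Data.Nat.ListAction using (product)
open import Data.List.Relation.Unary.All using (All)
open import Data.Nat.Combinatorics using (_C_)
open import Relation.Binary.PropositionalEquality using (_≢_)

-- Relation symbols are represented by the
-- list of their arities (one entry per symbol); Rels must be nonempty and
-- every arity ≥ 1.  Constant symbols are represented by their number |Cons|.
record Signature : Set where
  field
    rels      : List ℕ
    relsNE    : rels ≢ []
    arities≥1 : All (1 ≤_) rels
    cons      : ℕ

open Signature public

width : Signature → ℕ
width σ = foldr _⊔_ 0 (rels σ)

numTypes : Signature → ℕ → ℕ
numTypes σ k = product (map (λ a → 2 ^ ((k + cons σ) ^ a)) (rels σ))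

lhsProd : Signature → ℕ → ℕ
lhsProd σ w = product (map (λ i → numTypes σ (suc i) ^ ((w Data.Nat.∸ 1) C i)) (upTo w))

-- Take a single w-ary relation symbol and c = 2w² constants, so that |τ_k| = 2^((k+c)^w).
-- The exponent of the left-hand side is Σ_i C(w-1,i) (i+1+c)^w ≥ 2^(w-1) c^w, whereas
-- (w+c)^w ≤ 2 c^w by Bernoulli's inequality because c ≥ 2w². So the ratio of the exponents
-- is at least 2^(w-2) ≥ 2^w/(w+1)², which is far more than needed: only w ≥ 1 is used, and
-- the tenth root of the hypothesis is weakened to p (w+1)² ≤ 2^w q.

module Submission where

open import Defs
open import Data.Nat using (ℕ; _+_; _*_; _^_; _≤_)
open import Data.Product using (Σ; _×_)
open import Relation.Binary.PropositionalEquality using (_≡_)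

open import Data.Nat using (zero; suc; _∸_; s≤s; NonZero; >-nonZero⁻¹)
open import Data.Nat.Properties
open import Data.Nat.ListAction using (sum; product)
open import Data.Nat.ListAction.Properties using (sum-++)
open import Data.Nat.Combinatorics using (_C_; nCk+nC[k+1]≡[n+1]C[k+1]; k>n⇒nCk≡0)
open import Data.Nat.Solver using (module +-*-Solver)
open import Data.List using (List; []; _∷_; _++_; map; upTo; applyUpTo)
open import Data.List.Properties using (map-cong; map-upTo; applyUpTo-∷ʳ)
open import Data.List.Relation.Unary.All using (_∷_; [])
open import Data.Product using (_,_)
open import Function using (_∘_)
open import Relation.Binary.PropositionalEquality using (refl; sym; trans; cong; cong₂; _≗_; module ≡-Reasoning)

open +-*-Solver using (solve; _:=_; _:+_; _:*_; con)

^-distribʳ-* : ∀ m n o → (m * n) ^ o ≡ m ^ o * n ^ o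
^-distribʳ-* m n zero    = refl
^-distribʳ-* m n (suc o) = begin
  m * n * (m * n) ^ o      ≡⟨ cong (m * n *_) (^-distribʳ-* m n o) ⟩
  m * n * (m ^ o * n ^ o)  ≡⟨ solve 4 (λ a b c d → a :* b :* (c :* d) := a :* c :* (b :* d)) refl m n (m ^ o) (n ^ o) ⟩
  m * m ^ o * (n * n ^ o)  ∎
  where open ≡-Reasoning

m^[1+n]≤o*p^[1+n]⇒m≤o*p : ∀ m n o p .{{_ : NonZero o}} → m ^ suc n ≤ o * p ^ suc n → m ≤ o * p
m^[1+n]≤o*p^[1+n]⇒m≤o*p m n o p m^n≤op^n = ≮⇒≥ λ op<m → <-irrefl refl (begin-strict
  (o * p) ^ suc n        <⟨ ^-monoˡ-< (suc n) op<m ⟩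
  m ^ suc n              ≤⟨ m^n≤op^n ⟩
  o * p ^ suc n          ≤⟨ *-monoˡ-≤ (p ^ suc n) (m≤m*n o (o ^ n) {{m^n≢0 o n}}) ⟩
  o ^ suc n * p ^ suc n  ≡⟨ ^-distribʳ-* o p (suc n) ⟨
  (o * p) ^ suc n        ∎)
  where open ≤-Reasoning

product-map-^ : ∀ b f (l : List ℕ) → product (map (λ i → b ^ f i) l) ≡ b ^ sum (map f l)
product-map-^ b f []      = refl
product-map-^ b f (i ∷ l) = begin
  b ^ f i * product (map (λ i → b ^ f i) l)  ≡⟨ cong (b ^ f i *_) (product-map-^ b f l) ⟩
  b ^ f i * b ^ sum (map f l)                ≡⟨ ^-distribˡ-+-* b (f i) (sum (map f l)) ⟨
  b ^ (f i + sum (map f l))                  ∎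
  where open ≡-Reasoning

[a+d]^n*x≤a^[1+n] : ∀ a d n x → x + n * d ≤ a → (a + d) ^ n * x ≤ a ^ suc n
[a+d]^n*x≤a^[1+n] a d zero x x≤a = begin
  1 * x     ≡⟨ *-identityˡ x ⟩
  x         ≤⟨ m+n≤o⇒m≤o x x≤a ⟩
  a         ≡⟨ *-identityʳ a ⟨
  a * 1     ∎
  where open ≤-Reasoning
[a+d]^n*x≤a^[1+n] a d (suc n) x x+[1+n]d≤a = begin
  (a + d) ^ suc n * x          ≡⟨ solve 4 (λ A D X Y → (A :+ D) :* Y :* X := Y :* ((A :+ D) :* X)) refl a d x ((a + d) ^ n) ⟩
  (a + d) ^ n * ((a + d) * x)  ≤⟨ *-monoʳ-≤ ((a + d) ^ n) [a+d]x≤a[x+d] ⟩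
  (a + d) ^ n * (a * (x + d))  ≡⟨ solve 4 (λ A D X Y → Y :* (A :* (X :+ D)) := A :* (Y :* (X :+ D))) refl a d x ((a + d) ^ n) ⟩
  a * ((a + d) ^ n * (x + d))  ≤⟨ *-monoʳ-≤ a ([a+d]^n*x≤a^[1+n] a d n (x + d) x+d+nd≤a) ⟩
  a * a ^ suc n                ∎
  where
  open ≤-Reasoning
  x+d+nd≤a : x + d + n * d ≤ a
  x+d+nd≤a = ≤-trans (≤-reflexive (+-assoc x d (n * d))) x+[1+n]d≤a
  [a+d]x≤a[x+d] : (a + d) * x ≤ a * (x + d)
  [a+d]x≤a[x+d] = begin
    (a + d) * x    ≡⟨ solve 3 (λ A D X → (A :+ D) :* X := A :* X :+ X :* D) refl a d x ⟩
    a * x + x * d  ≤⟨ +-monoʳ-≤ (a * x) (*-monoˡ-≤ d (m+n≤o⇒m≤o x x+[1+n]d≤a)) ⟩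
    a * x + a * d  ≡⟨ *-distribˡ-+ a x d ⟨
    a * (x + d)    ∎

[n+c]^n≤2*c^n : ∀ n .{{_ : NonZero n}} → let c = n * n + n * n in (n + c) ^ n ≤ 2 * c ^ n
[n+c]^n≤2*c^n n = *-cancelʳ-≤ ((n + c) ^ n) (2 * c ^ n) (n * n) {{m*n≢0 n n}} (begin
  (n + c) ^ n * (n * n)  ≡⟨ cong (λ x → x ^ n * (n * n)) (+-comm n c) ⟩
  (c + n) ^ n * (n * n)  ≤⟨ [a+d]^n*x≤a^[1+n] c n n (n * n) ≤-refl ⟩
  c * c ^ n              ≡⟨ solve 2 (λ N X → (N :* N :+ N :* N) :* X := con 2 :* X :* (N :* N)) refl n (c ^ n) ⟩
  2 * c ^ n * (n * n)    ∎)
  where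
  open ≤-Reasoning
  c : ℕ
  c = n * n + n * n

sum-applyUpTo-cong : ∀ {f g} → f ≗ g → ∀ n → sum (applyUpTo f n) ≡ sum (applyUpTo g n)
sum-applyUpTo-cong f≗g zero    = refl
sum-applyUpTo-cong f≗g (suc n) = cong₂ _+_ (f≗g 0) (sum-applyUpTo-cong (f≗g ∘ suc) n)

sum-applyUpTo-mono-≤ : ∀ {f g} → (∀ i → f i ≤ g i) → ∀ n → sum (applyUpTo f n) ≤ sum (applyUpTo g n)
sum-applyUpTo-mono-≤ f≤g zero    = ≤-refl
sum-applyUpTo-mono-≤ f≤g (suc n) = +-mono-≤ (f≤g 0) (sum-applyUpTo-mono-≤ (f≤g ∘ suc) n)

sum-applyUpTo-distrib-+ : ∀ f g n →
  sum (applyUpTo (λ i → f i + g i) n) ≡ sum (applyUpTo f n) + sum (applyUpTo g n)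
sum-applyUpTo-distrib-+ f g zero    = refl
sum-applyUpTo-distrib-+ f g (suc n) = begin
  f 0 + g 0 + sum (applyUpTo (λ i → f (suc i) + g (suc i)) n)
    ≡⟨ cong (f 0 + g 0 +_) (sum-applyUpTo-distrib-+ (f ∘ suc) (g ∘ suc) n) ⟩
  f 0 + g 0 + (sum (applyUpTo (f ∘ suc) n) + sum (applyUpTo (g ∘ suc) n))
    ≡⟨ solve 4 (λ a b c d → a :+ b :+ (c :+ d) := a :+ c :+ (b :+ d)) refl (f 0) (g 0) _ _ ⟩
  f 0 + sum (applyUpTo (f ∘ suc) n) + (g 0 + sum (applyUpTo (g ∘ suc) n)) ∎
  where open ≡-Reasoning

sum-applyUpTo-suc : ∀ f n → sum (applyUpTo f (suc n)) ≡ sum (applyUpTo f n) + f n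
sum-applyUpTo-suc f n = begin
  sum (applyUpTo f (suc n))            ≡⟨ cong sum (applyUpTo-∷ʳ f n) ⟨
  sum (applyUpTo f n ++ f n ∷ [])      ≡⟨ sum-++ (applyUpTo f n) (f n ∷ []) ⟩
  sum (applyUpTo f n) + (f n + 0)      ≡⟨ cong (sum (applyUpTo f n) +_) (+-identityʳ (f n)) ⟩
  sum (applyUpTo f n) + f n            ∎
  where open ≡-Reasoning

*-distribˡ-sum-applyUpTo : ∀ m f n → m * sum (applyUpTo f n) ≡ sum (applyUpTo (λ i → m * f i) n)
*-distribˡ-sum-applyUpTo m f zero    = *-zeroʳ m
*-distribˡ-sum-applyUpTo m f (suc n) = trans (*-distribˡ-+ m (f 0) _) (cong (m * f 0 +_) (*-distribˡ-sum-applyUpTo m (f ∘ suc) n))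

sum-binomial : ∀ m → sum (applyUpTo (m C_) (suc m)) ≡ 2 ^ m
sum-binomial zero    = refl
sum-binomial (suc m) = begin
  1 + sum (applyUpTo (λ i → suc m C suc i) (suc m))
    ≡⟨ cong (1 +_) (sum-applyUpTo-cong (λ i → sym (nCk+nC[k+1]≡[n+1]C[k+1] m i)) (suc m)) ⟩
  1 + sum (applyUpTo (λ i → m C i + m C suc i) (suc m))
    ≡⟨ cong (1 +_) (sum-applyUpTo-distrib-+ (m C_) (λ i → m C suc i) (suc m)) ⟩
  1 + (row + shifted)
    ≡⟨ solve 3 (λ a b c → a :+ (b :+ c) := b :+ (a :+ c)) refl 1 row shifted ⟩
  row + (1 + shifted)
    -- m C 0 reduces to 1, so 1 + shifted is the sum of row m over suc (suc m) indices
    ≡⟨ cong (row +_) (sum-applyUpTo-suc (m C_) (suc m)) ⟩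
  row + (row + m C suc m)
    ≡⟨ cong₂ (λ r s → r + (r + s)) (sum-binomial m) (k>n⇒nCk≡0 (n<1+n m)) ⟩
  2 ^ m + (2 ^ m + 0) ∎
  where
  open ≡-Reasoning
  row shifted : ℕ
  row     = sum (applyUpTo (m C_) (suc m))
  shifted = sum (applyUpTo (λ i → m C suc i) (suc m))

weightedBinomialSum-≥ : ∀ m (g : ℕ → ℕ) b → (∀ i → b ≤ g i) →
  b * 2 ^ m ≤ sum (applyUpTo (λ i → g i * (m C i)) (suc m))
weightedBinomialSum-≥ m g b b≤g = begin
  b * 2 ^ m                                    ≡⟨ cong (b *_) (sum-binomial m) ⟨
  b * sum (applyUpTo (m C_) (suc m))           ≡⟨ *-distribˡ-sum-applyUpTo b (m C_) (suc m) ⟩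
  sum (applyUpTo (λ i → b * (m C i)) (suc m))  ≤⟨ sum-applyUpTo-mono-≤ (λ i → *-monoˡ-≤ (m C i) (b≤g i)) (suc m) ⟩
  sum (applyUpTo (λ i → g i * (m C i)) (suc m)) ∎
  where open ≤-Reasoning

singleRelation : (a c : ℕ) .{{_ : NonZero a}} → Signature
singleRelation a c = record
  { rels = a ∷ []; relsNE = λ (); arities≥1 = >-nonZero⁻¹ a ∷ []; cons = c }

module _ (a c : ℕ) .{{_ : NonZero a}} where

  width-singleRelation : width (singleRelation a c) ≡ a
  width-singleRelation = ⊔-identityʳ a

  numTypes-singleRelation : ∀ k → numTypes (singleRelation a c) k ≡ 2 ^ ((k + c) ^ a)
  numTypes-singleRelation k = *-identityʳ _

  lhsProd-singleRelation : ∀ w →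
    lhsProd (singleRelation a c) w ≡ 2 ^ sum (applyUpTo (λ i → (suc i + c) ^ a * ((w ∸ 1) C i)) w)
  lhsProd-singleRelation w = begin
    product (map (λ i → numTypes (singleRelation a c) (suc i) ^ ((w ∸ 1) C i)) (upTo w))
      ≡⟨ cong product (map-cong factor (upTo w)) ⟩
    product (map (λ i → 2 ^ ((suc i + c) ^ a * ((w ∸ 1) C i))) (upTo w))
      ≡⟨ product-map-^ 2 _ (upTo w) ⟩
    2 ^ sum (map (λ i → (suc i + c) ^ a * ((w ∸ 1) C i)) (upTo w))
      ≡⟨ cong (λ l → 2 ^ sum l) (map-upTo _ w) ⟩
    2 ^ sum (applyUpTo (λ i → (suc i + c) ^ a * ((w ∸ 1) C i)) w) ∎
    where
    open ≡-Reasoning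
    factor : ∀ i → numTypes (singleRelation a c) (suc i) ^ ((w ∸ 1) C i) ≡ 2 ^ ((suc i + c) ^ a * ((w ∸ 1) C i))
    factor i = trans (cong (_^ ((w ∸ 1) C i)) (numTypes-singleRelation (suc i))) (^-*-assoc 2 ((suc i + c) ^ a) ((w ∸ 1) C i))

module SingleRelationWitness (m : ℕ) where

  w c S : ℕ
  w = suc m
  c = w * w + w * w
  S = sum (applyUpTo (λ i → (suc i + c) ^ w * (m C i)) w)

  σ : Signature
  σ = singleRelation w c

  numTypes^p≡2^[[w+c]^w*p] : ∀ p → numTypes σ w ^ p ≡ 2 ^ ((w + c) ^ w * p)
  numTypes^p≡2^[[w+c]^w*p] p = trans (cong (_^ p) (numTypes-singleRelation w c w)) (^-*-assoc 2 ((w + c) ^ w) p)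

  lhsProd^q≡2^[S*q] : ∀ q → lhsProd σ w ^ q ≡ 2 ^ (S * q)
  lhsProd^q≡2^[S*q] q = trans (cong (_^ q) (lhsProd-singleRelation w c w)) (^-*-assoc 2 S q)

  c^w*2^m≤S : c ^ w * 2 ^ m ≤ S
  c^w*2^m≤S = weightedBinomialSum-≥ m _ (c ^ w) (λ i → ^-monoˡ-≤ w (m≤n+m c (suc i)))

  [w+c]^w*p≤S*q : ∀ p q → p * (w + 1) ^ 2 ≤ 2 ^ w * q → (w + c) ^ w * p ≤ S * q
  [w+c]^w*p≤S*q p q pK≤2^w*q = *-cancelˡ-≤ K {{m^n≢0 (w + 1) 2}} (begin
    K * ((w + c) ^ w * p)      ≡⟨ solve 3 (λ k e x → k :* (e :* x) := e :* (x :* k)) refl K ((w + c) ^ w) p ⟩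
    (w + c) ^ w * (p * K)      ≤⟨ *-mono-≤ ([n+c]^n≤2*c^n w) pK≤2^w*q ⟩
    2 * c ^ w * (2 ^ w * q)    ≡⟨ solve 3 (λ x y z → con 2 :* x :* (con 2 :* y :* z) := con 4 :* (z :* (x :* y))) refl (c ^ w) (2 ^ m) q ⟩
    4 * (q * (c ^ w * 2 ^ m))  ≤⟨ *-mono-≤ 4≤K (*-monoʳ-≤ q c^w*2^m≤S) ⟩
    K * (q * S)                ≡⟨ cong (K *_) (*-comm q S) ⟩
    K * (S * q)                ∎)
    where
    open ≤-Reasoning
    K : ℕ
    K = (w + 1) ^ 2
    4≤K : 4 ≤ K
    4≤K = ^-monoˡ-≤ 2 (s≤s (m≤n+m 1 m))

claim20 : (w : ℕ) → 5 ≤ w →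
    Σ Signature (λ σ → width σ ≡ w ×
      ((p q : ℕ) → 1 ≤ q →
        (p * (w + 1) ^ 2) ^ 10 ≤ 2 ^ w * q ^ 10 →
        numTypes σ w ^ p ≤ lhsProd σ w ^ q))
claim20 (suc m) _ = σ , width-singleRelation w c , numTypes^p≤lhsProd^q
  where
  open SingleRelationWitness m
  numTypes^p≤lhsProd^q : (p q : ℕ) → 1 ≤ q → (p * (w + 1) ^ 2) ^ 10 ≤ 2 ^ w * q ^ 10 →
    numTypes σ w ^ p ≤ lhsProd σ w ^ q
  numTypes^p≤lhsProd^q p q _ [pK]^10≤2^w*q^10 = begin
    numTypes σ w ^ p       ≡⟨ numTypes^p≡2^[[w+c]^w*p] p ⟩
    2 ^ ((w + c) ^ w * p)  ≤⟨ ^-monoʳ-≤ 2 ([w+c]^w*p≤S*q p q pK≤2^w*q) ⟩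
    2 ^ (S * q)            ≡⟨ lhsProd^q≡2^[S*q] q ⟨
    lhsProd σ w ^ q        ∎
    where
    open ≤-Reasoning
    pK≤2^w*q : p * (w + 1) ^ 2 ≤ 2 ^ w * q
    pK≤2^w*q = m^[1+n]≤o*p^[1+n]⇒m≤o*p _ 9 (2 ^ w) q {{m^n≢0 2 w}} [pK]^10≤2^w*q^10
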